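{- A barrier $B \subseteq [\mathbb{N}]^{<\omega}$ has order type at most $\omega^\omega$ if and only if $B$ is $\omega$-bounded.
   Context: $[\mathbb{N}]^{<\omega}$ is the set of finite subsets of $\mathbb{N}$, identified with finite increasing sequences. $\operatorname{base}(B) = \{n : \exists s \in B\, (n \in s)\}$. A set $B \subseteq [\mathbb{N}]^{<\omega}$ is a barrier if (1) $\operatorname{base}(B)$ is infinite; (2) for every infinite $X \subseteq \operatorname{base}(B)$ there is $s \in B$ that is an initial segment of $X$ (in increasing enumeration); (3) for all $s, t \in B$, $s$ is not a proper subset of $t$. On a barrier, the lexicographic order ($s <_{\mathrm{lex}} t$ iff $s(x) < t(x)$ at the least $x$ where they differ) is a well-order, and the order type of $B$ is the order type of $(B, <_{\mathrm{lex}})$. For $h : \mathbb{N} \to \mathbb{N}$, $[\mathbb{N}]^{\leq h(\cdot)}$ is the set of finite $s$ with $|s| \leq h(\min s)$. $B$ is $\omega$-bounded if $B \subseteq [\mathbb{N}]^{\leq h(\cdot)}$ for some function $h : \mathbb{N} \to \mathbb{N}$. -}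

module Defs where

open import Data.Nat using (ℕ; zero; suc; _≤_; _<_; _≥_)
open import Data.List using (List; []; _∷_; _++_; length; tabulate)
open import Data.List.Membership.Propositional using (_∈_)
open import Data.List.Relation.Unary.Linked using (Linked)
open import Data.Fin using (toℕ)
open import Data.Product using (Σ; ∃; _×_; _,_)
open import Data.Unit using (⊤)
open import Relation.Binary.PropositionalEquality using (_≡_; _≢_)
open import Relation.Nullary using (¬_)

-- Finite subsets of ℕ are represented as strictly increasing lists
-- (their increasing enumeration).
Incr : List ℕ → Set
Incr = Linked _<_

Family : Set₁
Family = List ℕ → Set

base : Family → ℕ → Set
base B n = ∃ λ s → B s × n ∈ s

_⊆ˡ_ : List ℕ → List ℕ → Set
s ⊆ˡ t = ∀ x → x ∈ s → x ∈ t

-- An infinite subset of ℕ, given by its increasing enumeration.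
StrictlyIncreasing : (ℕ → ℕ) → Set
StrictlyIncreasing f = ∀ i → f i < f (suc i)

initSeg : (ℕ → ℕ) → ℕ → List ℕ
initSeg f k = tabulate {n = k} (λ i → f (toℕ i))

record Barrier (B : Family) : Set where
  field
    members-incr : ∀ s → B s → Incr s
    base-infinite : ∀ m → ∃ λ n → m ≤ n × base B n
    initial : ∀ (f : ℕ → ℕ) → StrictlyIncreasing f → (∀ i → base B (f i)) →
              ∃ λ k → B (initSeg f k)
    sperner : ∀ s t → B s → B t → ¬ (s ⊆ˡ t × s ≢ t)

data _<lex_ : List ℕ → List ℕ → Set where
  diff : ∀ (p s' t' : List ℕ) (a b : ℕ) → a < b →
         (p ++ (a ∷ s')) <lex (p ++ (b ∷ t'))

-- Ordinals below ω^ω in Cantor normal form ω^{e₁} + ... + ω^{e_k}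
-- with e₁ ≥ ... ≥ e_k, represented by the list of exponents.
CNF : List ℕ → Set
CNF = Linked _≥_

data _<ω^ω_ : List ℕ → List ℕ → Set where
  prefix : ∀ (p : List ℕ) (b : ℕ) (t' : List ℕ) → p <ω^ω (p ++ (b ∷ t'))
  diff   : ∀ (p s' t' : List ℕ) (a b : ℕ) → a < b →
           (p ++ (a ∷ s')) <ω^ω (p ++ (b ∷ t'))

-- The order type of (B, <lex) is at most ω^ω: (B, <lex) order-embeds
-- into the ordinal ω^ω = {CNFs with finite exponents}.
OrderTypeLeωω : Family → Set
OrderTypeLeωω B =
  Σ (List ℕ → List ℕ) λ f →
    (∀ s → B s → CNF (f s)) ×
    (∀ s t → B s → B t → s <lex t → f s <ω^ω f t)

-- |s| ≤ h(min s)  (the empty set imposes no constraint; it never lies in a barrier)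
LenBound : (ℕ → ℕ) → List ℕ → Set
LenBound h [] = ⊤
LenBound h (a ∷ s) = length (a ∷ s) ≤ h a

ωBounded : Family → Set
ωBounded B = Σ (ℕ → ℕ) λ h → ∀ s → B s → LenBound h s

{-# OPTIONS --safe #-}
-- If |s| ≤ h (min s) on B, send s = (a, x₁, …, x_k) to the ordinal
-- ω^(H a) + ω^(h a − 1)·x₁ + ⋯ + ω^(h a − k)·x_k, with H strictly increasing and
-- H ≥ h; two members first differ at a position below h a, so this preserves order.
--
-- Conversely, let f embed (B, <lex) into ω^ω. All members of B with minimum a lie
-- lex-below a single member t_a, so their images lie below f t_a. Say γ <[ e ] δ if
-- γ < δ already after deleting the terms ω^d with d < e from both. Key lemma: if the
-- increasing list (a, u, xs) is a proper subset of a member of B and β bounds f on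
-- the members of B starting with (a, xs), then f r <[ |u| ] β for each such member r.
-- For the induction step drop the first entry c of u and pick ever larger yᵢ in
-- base B; members rᵢ starting with (a, xs, yᵢ) satisfy f r < f rᵢ < β and, by
-- induction, f rᵢ <[ |u| − 1 ] f rᵢ₊₁, which forces a gap at level |u|, because the
-- coefficients of ω^(|u| − 1) cannot increase forever below β. For s = (a, c, u) ∈ B,
-- (a, u) ⊊ s, so the leading exponent of f t_a is at least |s| − 2.

module Submission where

open import Defs
open import Function using (_∘_)
open import Function.Bundles using (_⇔_; mk⇔)
open import Data.Nat using (ℕ; zero; suc; _+_; _≤_; _<_; z≤n; s≤s; s≤s⁻¹; _≤?_)
open import Data.Nat.Properties
open import Data.List using (List; []; _∷_; _++_; length; replicate)
open import Data.Nat.ListAction using (sum)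
open import Data.List.Properties
  using (++-assoc; ++-identityʳ; ++-cancelˡ; length-replicate; length-++-≤ˡ)
open import Data.List.Membership.Propositional using (_∈_; _∉_)
open import Data.List.Membership.Propositional.Properties using (∈-++⁺ʳ)
open import Data.List.Relation.Unary.All as All using (All; []; _∷_)
open import Data.List.Relation.Unary.All.Properties as All using ()
open import Data.List.Relation.Unary.AllPairs as AllPairs using ()
open import Data.List.Relation.Unary.Any using (here; there)
open import Data.List.Relation.Unary.Linked as Linked using (Linked; []; [-]; _∷_)
open import Data.List.Relation.Unary.Linked.Properties using (Linked⇒AllPairs)
open import Data.List.Relation.Binary.Lex.Core using (halt; this; next)
open import Data.List.Relation.Binary.Lex.Strict as Lex using (Lex-<)
open import Data.List.Relation.Binary.Pointwise as Pointwise using ()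
open import Data.Product using (∃; _×_; _,_; proj₁; proj₂)
open import Data.Sum using (_⊎_; inj₁; inj₂)
open import Data.Unit using (tt)
open import Relation.Nullary using (¬_; yes; no; contradiction)
open import Relation.Binary using (Transitive; Irreflexive)
open import Relation.Binary.PropositionalEquality
import Relation.Binary.Construct.StrictToNonStrict as StrictToNonStrict

StrictlyIncreasing-< : ∀ {f} → StrictlyIncreasing f → ∀ {a b} → a < b → f a < f b
StrictlyIncreasing-< incr {a} {suc b} a<1+b with m<1+n⇒m<n∨m≡n a<1+b
... | inj₁ a<b  = <-trans (StrictlyIncreasing-< incr a<b) (incr b)
... | inj₂ refl = incr a

StrictlyIncreasing-≥id : ∀ {f} → StrictlyIncreasing f → ∀ i → i ≤ f i
StrictlyIncreasing-≥id incr zero    = z≤n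
StrictlyIncreasing-≥id incr (suc i) = ≤-trans (s≤s (StrictlyIncreasing-≥id incr i)) (incr i)

∈⇒≤sum : ∀ xs {x} → x ∈ xs → x ≤ sum xs
∈⇒≤sum (y ∷ xs) (here refl) = m≤m+n y (sum xs)
∈⇒≤sum (y ∷ xs) (there x∈)  = ≤-trans (∈⇒≤sum xs x∈) (m≤n+m (sum xs) y)

module Enumeration {P : ℕ → Set} (unbounded : ∀ m → ∃ λ n → m ≤ n × P n) where

  enumFrom : ℕ → ℕ → ℕ
  enumFrom m zero    = proj₁ (unbounded m)
  enumFrom m (suc i) = proj₁ (unbounded (suc (enumFrom m i)))

  enumFrom-incr : ∀ m → StrictlyIncreasing (enumFrom m)
  enumFrom-incr m i = proj₁ (proj₂ (unbounded (suc (enumFrom m i))))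

  enumFrom-∈ : ∀ m i → P (enumFrom m i)
  enumFrom-∈ m zero    = proj₂ (proj₂ (unbounded m))
  enumFrom-∈ m (suc i) = proj₂ (proj₂ (unbounded (suc (enumFrom m i))))

  enumFrom-≥ : ∀ m i → m ≤ enumFrom m i
  enumFrom-≥ m zero    = proj₁ (proj₂ (unbounded m))
  enumFrom-≥ m (suc i) = ≤-trans (enumFrom-≥ m i) (<⇒≤ (enumFrom-incr m i))

  enumFrom-beyond : ∀ xs i {x} → x ∈ xs → x < enumFrom (suc (sum xs)) i
  enumFrom-beyond xs i x∈xs = <-≤-trans (s≤s (∈⇒≤sum xs x∈xs)) (enumFrom-≥ _ i)

infixr 5 _++ₛ_

_++ₛ_ : List ℕ → (ℕ → ℕ) → ℕ → ℕ
([]      ++ₛ X) i       = X i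
((x ∷ v) ++ₛ X) zero    = x
((x ∷ v) ++ₛ X) (suc i) = (v ++ₛ X) i

++ₛ-incr : ∀ v {X} → Incr (v ++ X 0 ∷ []) → StrictlyIncreasing X →
           StrictlyIncreasing (v ++ₛ X)
++ₛ-incr []          _          X-incr i       = X-incr i
++ₛ-incr (x ∷ [])    (x<X0 ∷ _) _      zero    = x<X0
++ₛ-incr (x ∷ y ∷ v) (x<y ∷ _)  _      zero    = x<y
++ₛ-incr (x ∷ v)     incr       X-incr (suc i) = ++ₛ-incr v (Linked.tail incr) X-incr i

++ₛ-all : ∀ {P : ℕ → Set} v {X} → (∀ x → x ∈ v → P x) → (∀ i → P (X i)) →
          ∀ i → P ((v ++ₛ X) i)
++ₛ-all []      Pv PX i       = PX i
++ₛ-all (x ∷ v) Pv PX zero    = Pv x (here refl)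
++ₛ-all (x ∷ v) Pv PX (suc i) = ++ₛ-all v (λ y → Pv y ∘ there) PX i

initSeg-++ₛ : ∀ v X k → initSeg (v ++ₛ X) k ⊆ˡ v ⊎
                        ∃ λ n → initSeg (v ++ₛ X) k ≡ v ++ initSeg X (suc n)
initSeg-++ₛ []      X zero    = inj₁ (λ _ ())
initSeg-++ₛ []      X (suc n) = inj₂ (n , refl)
initSeg-++ₛ (x ∷ v) X zero    = inj₁ (λ _ ())
initSeg-++ₛ (x ∷ v) X (suc k) with initSeg-++ₛ v X k
... | inj₁ ⊆v       = inj₁ λ { _ (here refl) → here refl ; y (there y∈) → there (⊆v y y∈) }
... | inj₂ (n , eq) = inj₂ (n , cong (x ∷_) eq)

-- ω-bounded families embed into ω^ω

∷-<ω^ω : ∀ x {u v} → u <ω^ω v → (x ∷ u) <ω^ω (x ∷ v)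
∷-<ω^ω x (prefix p b t')        = prefix (x ∷ p) b t'
∷-<ω^ω x (diff p s' t' a b a<b) = diff (x ∷ p) s' t' a b a<b

++-<ω^ω : ∀ p {u v} → u <ω^ω v → (p ++ u) <ω^ω (p ++ v)
++-<ω^ω []      u<v = u<v
++-<ω^ω (x ∷ p) u<v = ∷-<ω^ω x (++-<ω^ω p u<v)

CNF-weakenHead : ∀ {m k l} → m ≤ k → CNF (m ∷ l) → CNF (k ∷ l)
CNF-weakenHead m≤k [-]         = [-]
CNF-weakenHead m≤k (m≥y ∷ cnf) = ≤-trans m≥y m≤k ∷ cnf

CNF-replicate : ∀ x {m k l} → m ≤ k → CNF (m ∷ l) → CNF (k ∷ replicate x m ++ l)
CNF-replicate zero    m≤k cnf = CNF-weakenHead m≤k cnf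
CNF-replicate (suc x) m≤k cnf = m≤k ∷ CNF-replicate x ≤-refl cnf

-- The normal form of ω^(m ∸ 1)·x₁ + ω^(m ∸ 2)·x₂ + ⋯ + x_m; entries past x_m are ignored.
cnfPoly : ℕ → List ℕ → List ℕ
cnfPoly zero    _        = []
cnfPoly (suc m) []       = []
cnfPoly (suc m) (x ∷ xs) = replicate x m ++ cnfPoly m xs

cnfPoly-cnf : ∀ m xs {k} → m ≤ suc k → CNF (k ∷ cnfPoly m xs)
cnfPoly-cnf zero    _        _         = [-]
cnfPoly-cnf (suc m) []       _         = [-]
cnfPoly-cnf (suc m) (x ∷ xs) (s≤s m≤k) = CNF-replicate x m≤k (cnfPoly-cnf m xs (n≤1+n m))

cnfPoly-exponents< : ∀ m xs → All (_< m) (cnfPoly m xs)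
cnfPoly-exponents< zero    _        = []
cnfPoly-exponents< (suc m) []       = []
cnfPoly-exponents< (suc m) (x ∷ xs) =
  All.++⁺ (All.replicate⁺ x (n<1+n m)) (All.map m<n⇒m<1+n (cnfPoly-exponents< m xs))

replicate-<ω^ω : ∀ m {a b u w} → a < b → All (_< m) u →
                 (replicate a m ++ u) <ω^ω (replicate b m ++ w)
replicate-<ω^ω m {zero}  {suc b} {[]}    {w} _ _         = prefix [] m (replicate b m ++ w)
replicate-<ω^ω m {zero}  {suc b} {x ∷ u} {w} _ (x<m ∷ _) = diff [] u (replicate b m ++ w) x m x<m
replicate-<ω^ω m {suc a} {suc b} (s≤s a<b) u<m           = ∷-<ω^ω m (replicate-<ω^ω m a<b u<m)

cnfPoly-<ω^ω : ∀ m p {a b s t} → a < b → length p < m →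
               cnfPoly m (p ++ a ∷ s) <ω^ω cnfPoly m (p ++ b ∷ t)
cnfPoly-<ω^ω (suc m) []      a<b _           = replicate-<ω^ω m a<b (cnfPoly-exponents< m _)
cnfPoly-<ω^ω (suc m) (x ∷ p) a<b (s≤s |p|<m) =
  ++-<ω^ω (replicate x m) (cnfPoly-<ω^ω m p a<b |p|<m)

module _ (h : ℕ → ℕ) where

  lead : ℕ → ℕ
  lead zero    = h zero
  lead (suc a) = suc (lead a + h (suc a))

  h≤lead : ∀ a → h a ≤ lead a
  h≤lead zero    = ≤-refl
  h≤lead (suc a) = m≤n⇒m≤1+n (m≤n+m (h (suc a)) (lead a))

  lead-incr : StrictlyIncreasing lead
  lead-incr a = s≤s (m≤m+n (lead a) _)

  encode : List ℕ → List ℕ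
  encode []      = []
  encode (a ∷ s) = lead a ∷ cnfPoly (h a) s

  encode-cnf : ∀ s → CNF (encode s)
  encode-cnf []      = []
  encode-cnf (a ∷ s) = cnfPoly-cnf (h a) s (m≤n⇒m≤1+n (h≤lead a))

  encode-<ω^ω : ∀ p {a b s t} → a < b → LenBound h (p ++ a ∷ s) →
                encode (p ++ a ∷ s) <ω^ω encode (p ++ b ∷ t)
  encode-<ω^ω []      {a} {b} {s} {t} a<b _ =
    diff [] (cnfPoly (h a) s) (cnfPoly (h b) t) (lead a) (lead b)
         (StrictlyIncreasing-< lead-incr a<b)
  encode-<ω^ω (c ∷ p) a<b |c∷p++a∷s|≤h =
    ∷-<ω^ω (lead c)
      (cnfPoly-<ω^ω (h c) p a<b (<-≤-trans (s≤s (length-++-≤ˡ p)) |c∷p++a∷s|≤h))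

ωBounded⇒OrderTypeLeωω : ∀ B → ωBounded B → OrderTypeLeωω B
ωBounded⇒OrderTypeLeωω B (h , bounded) = encode h , (λ s _ → encode-cnf h s) , embedding
  where
    embedding : ∀ s t → B s → B t → s <lex t → encode h s <ω^ω encode h t
    embedding _ _ Bs _ (diff p _ _ _ _ a<b) = encode-<ω^ω h p a<b (bounded _ Bs)

-- Truncated Cantor normal forms

infix 4 _<ᶜ_ _≤ᶜ_ _<[_]_

_<ᶜ_ : List ℕ → List ℕ → Set
_<ᶜ_ = Lex-< _≡_ _<_

<ᶜ-trans : Transitive _<ᶜ_
<ᶜ-trans = Lex.<-transitive isEquivalence (resp₂ _<_) <-trans

<ᶜ-irrefl : Irreflexive _≡_ _<ᶜ_
<ᶜ-irrefl refl = Lex.<-irreflexive <-irrefl (Pointwise.refl refl)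

_≤ᶜ_ : List ℕ → List ℕ → Set
_≤ᶜ_ = StrictToNonStrict._≤_ _≡_ _<ᶜ_

≤ᶜ-trans : Transitive _≤ᶜ_
≤ᶜ-trans = StrictToNonStrict.trans _≡_ _<ᶜ_ isEquivalence (resp₂ _<ᶜ_) <ᶜ-trans

≤ᶜ-antisym : ∀ {u v} → u ≤ᶜ v → v ≤ᶜ u → u ≡ v
≤ᶜ-antisym = StrictToNonStrict.antisym _≡_ _<ᶜ_ isEquivalence <ᶜ-trans <ᶜ-irrefl

∷-≤ᶜ : ∀ x {u v} → u ≤ᶜ v → x ∷ u ≤ᶜ x ∷ v
∷-≤ᶜ x (inj₁ u<v)  = inj₁ (next refl u<v)
∷-≤ᶜ x (inj₂ refl) = inj₂ refl

++-<ᶜ : ∀ p {u v} → u <ᶜ v → p ++ u <ᶜ p ++ v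
++-<ᶜ []      u<v = u<v
++-<ᶜ (x ∷ p) u<v = next refl (++-<ᶜ p u<v)

++-cancelˡ-<ᶜ : ∀ p {u v} → p ++ u <ᶜ p ++ v → u <ᶜ v
++-cancelˡ-<ᶜ []      u<v         = u<v
++-cancelˡ-<ᶜ (x ∷ p) (this x<x)  = contradiction x<x (<-irrefl refl)
++-cancelˡ-<ᶜ (x ∷ p) (next _ lt) = ++-cancelˡ-<ᶜ p lt

++-cancelˡ-≤ᶜ : ∀ p {u v} → p ++ u ≤ᶜ p ++ v → u ≤ᶜ v
++-cancelˡ-≤ᶜ p (inj₁ lt) = inj₁ (++-cancelˡ-<ᶜ p lt)
++-cancelˡ-≤ᶜ p (inj₂ eq) = inj₂ (++-cancelˡ p _ _ eq)

replicate-<ᶜ⁻¹ : ∀ {e m n} → replicate m e <ᶜ replicate n e → m < n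
replicate-<ᶜ⁻¹ {m = zero}  {zero}  []<[]        = contradiction []<[] Lex.xs≮[]
replicate-<ᶜ⁻¹ {m = zero}  {suc n} halt        = s≤s z≤n
replicate-<ᶜ⁻¹ {m = suc m} {suc n} (this e<e)  = contradiction e<e (<-irrefl refl)
replicate-<ᶜ⁻¹ {m = suc m} {suc n} (next _ lt) = s≤s (replicate-<ᶜ⁻¹ lt)

replicate-≤ᶜ⁻¹ : ∀ {e m n} → replicate m e ≤ᶜ replicate n e → m ≤ n
replicate-≤ᶜ⁻¹               (inj₁ lt) = <⇒≤ (replicate-<ᶜ⁻¹ lt)
replicate-≤ᶜ⁻¹ {m = m} {n} (inj₂ eq) =
  ≤-reflexive (trans (sym (length-replicate m)) (trans (cong length eq) (length-replicate n)))

<ω^ω⇒<ᶜ : ∀ {u v} → u <ω^ω v → u <ᶜ v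
<ω^ω⇒<ᶜ (prefix p b t')     = subst (_<ᶜ p ++ b ∷ t') (++-identityʳ p) (++-<ᶜ p halt)
<ω^ω⇒<ᶜ (diff p _ _ _ _ a<b) = ++-<ᶜ p (this a<b)

-- A normal form rounded down to a multiple of ω^e: its terms ω^d with d ≥ e.
truncate : ℕ → List ℕ → List ℕ
truncate e []      = []
truncate e (a ∷ γ) with e ≤? a
... | yes _ = a ∷ truncate e γ
... | no  _ = []

_<[_]_ : List ℕ → ℕ → List ℕ → Set
γ <[ e ] δ = truncate e γ <ᶜ truncate e δ

truncate-zero : ∀ γ → truncate 0 γ ≡ γ
truncate-zero []      = refl
truncate-zero (a ∷ γ) = cong (a ∷_) (truncate-zero γ)

truncate-mono : ∀ e {u v} → u <ᶜ v → truncate e u ≤ᶜ truncate e v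
truncate-mono e {v = b ∷ _} halt with e ≤? b
... | yes _ = inj₁ halt
... | no  _ = inj₂ refl
truncate-mono e {a ∷ _} {b ∷ _} (this a<b) with e ≤? a | e ≤? b
... | yes _   | yes _   = inj₁ (this a<b)
... | yes e≤a | no  e≰b = contradiction (≤-trans e≤a (<⇒≤ a<b)) e≰b
... | no  _   | yes _   = inj₁ halt
... | no  _   | no  _   = inj₂ refl
truncate-mono e {a ∷ _} (next refl u<v) with e ≤? a
... | yes _ = ∷-≤ᶜ a (truncate-mono e u<v)
... | no  _ = inj₂ refl

truncate-constant : ∀ e γ → CNF (e ∷ γ) → ∃ λ m → truncate e γ ≡ replicate m e
truncate-constant e []      _   = 0 , refl
truncate-constant e (a ∷ γ) (e≥a ∷ cnf) with e ≤? a
... | no  _   = 0 , refl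
... | yes e≤a with ≤-antisym e≤a e≥a
...   | refl with truncate-constant e γ cnf
...     | m , eq = suc m , cong (e ∷_) eq

truncate-suc : ∀ e γ → CNF γ → ∃ λ m → truncate e γ ≡ truncate (suc e) γ ++ replicate m e
truncate-suc e []      _   = 0 , refl
truncate-suc e (a ∷ γ) cnf with suc e ≤? a | e ≤? a
... | yes _   | yes _   = let m , eq = truncate-suc e γ (Linked.tail cnf) in m , cong (a ∷_) eq
... | yes e<a | no  e≰a = contradiction (<⇒≤ e<a) e≰a
... | no  _   | no  _   = 0 , refl
... | no  e≮a | yes e≤a with ≤-antisym e≤a (s≤s⁻¹ (≰⇒> e≮a))
...   | refl = let m , eq = truncate-constant e γ cnf in suc m , cong (e ∷_) eq

-- Otherwise all Γ i agree with β above e, and their coefficients of ω^e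
-- would increase forever while staying below that of β.
ascending⇒<[suc] : ∀ {e x β} {Γ : ℕ → List ℕ} → CNF β → (∀ i → CNF (Γ i)) →
                   (∀ i → x <ᶜ Γ i) → (∀ i → Γ i <ᶜ β) → (∀ i → Γ i <[ e ] Γ (suc i)) →
                   x <[ suc e ] β
ascending⇒<[suc] {e} {x} {β} {Γ} cnfβ cnfΓ x<Γ Γ<β ascending
  with ≤ᶜ-trans (truncate-mono (suc e) (x<Γ 0)) (truncate-mono (suc e) (Γ<β 0))
... | inj₁ x<β = x<β
... | inj₂ x≡β =
  contradiction (bounded (suc mβ)) (<⇒≱ (StrictlyIncreasing-≥id increasing (suc mβ)))
  where
    top : List ℕ
    top = truncate (suc e) β
    agree : ∀ i → truncate (suc e) (Γ i) ≡ top
    agree i = ≤ᶜ-antisym (truncate-mono (suc e) (Γ<β i))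
                         (subst (_≤ᶜ truncate (suc e) (Γ i)) x≡β (truncate-mono (suc e) (x<Γ i)))
    m : ℕ → ℕ
    m i = proj₁ (truncate-suc e (Γ i) (cnfΓ i))
    split : ∀ i → truncate e (Γ i) ≡ top ++ replicate (m i) e
    split i = trans (proj₂ (truncate-suc e (Γ i) (cnfΓ i)))
                    (cong (_++ replicate (m i) e) (agree i))
    mβ : ℕ
    mβ = proj₁ (truncate-suc e β cnfβ)
    increasing : StrictlyIncreasing m
    increasing i = replicate-<ᶜ⁻¹ (++-cancelˡ-<ᶜ top
      (subst₂ _<ᶜ_ (split i) (split (suc i)) (ascending i)))
    bounded : ∀ i → m i ≤ mβ
    bounded i = replicate-≤ᶜ⁻¹ (++-cancelˡ-≤ᶜ top
      (subst₂ _≤ᶜ_ (split i) (proj₂ (truncate-suc e β cnfβ)) (truncate-mono e (Γ<β i))))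

leadingExponent : List ℕ → ℕ
leadingExponent []      = 0
leadingExponent (b ∷ _) = b

<[]⇒≤leadingExponent : ∀ {k x} β → x <[ k ] β → k ≤ leadingExponent β
<[]⇒≤leadingExponent     []      x<[] = contradiction x<[] Lex.xs≮[]
<[]⇒≤leadingExponent {k} (b ∷ β) x<β with k ≤? b
... | yes k≤b = k≤b
... | no  _   = contradiction x<β Lex.xs≮[]

skip-⊆ : ∀ a u xs → (a ∷ xs) ⊆ˡ (a ∷ u ++ xs)
skip-⊆ a u xs _ (here x≡a)   = here x≡a
skip-⊆ a u xs _ (there x∈xs) = there (∈-++⁺ʳ u x∈xs)

snoc-⊆ : ∀ w {y} ts → (w ++ y ∷ []) ⊆ˡ (w ++ y ∷ ts)
snoc-⊆ []      ts _ (here x≡y)  = here x≡y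
snoc-⊆ (_ ∷ w) ts _ (here x≡a)  = here x≡a
snoc-⊆ (_ ∷ w) ts x (there x∈)  = there (snoc-⊆ w ts x x∈)

_⊑_ : List ℕ → List ℕ → Set
w ⊑ r = ∃ λ zs → w ++ zs ≡ r

snoc-⊑⇒<lex : ∀ w {y y' r} ts → (w ++ y ∷ []) ⊑ r → y < y' → r <lex (w ++ y' ∷ ts)
snoc-⊑⇒<lex w ts (zs , refl) y<y' = subst (_<lex _) (sym (++-assoc w _ zs)) (diff w zs ts _ _ y<y')

Incr-snoc : ∀ {w y} → Incr w → (∀ x → x ∈ w → x < y) → Incr (w ++ y ∷ [])
Incr-snoc []           below = [-]
Incr-snoc [-]          below = below _ (here refl) ∷ [-]
Incr-snoc (x<x' ∷ incr) below = x<x' ∷ Incr-snoc incr (λ x → below x ∘ there)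

Incr-drop2nd : ∀ {a c l} → Incr (a ∷ c ∷ l) → Incr (a ∷ l)
Incr-drop2nd {l = []}    _                  = [-]
Incr-drop2nd {l = _ ∷ _} (a<c ∷ c<d ∷ incr) = <-trans a<c c<d ∷ incr

Incr-dropInfix : ∀ {a} u {xs} → Incr (a ∷ u ++ xs) → Incr (a ∷ xs)
Incr-dropInfix []      incr = incr
Incr-dropInfix (c ∷ u) incr = Incr-dropInfix u (Incr-drop2nd incr)

Incr-∉ : ∀ {a c l} → Incr (a ∷ c ∷ l) → c ∉ a ∷ l
Incr-∉ (a<c ∷ _)    (here refl)  = <-irrefl refl a<c
Incr-∉ (_   ∷ incr) (there c∈l) =
  <-irrefl refl (All.lookup (AllPairs.head (Linked⇒AllPairs <-trans incr)) c∈l)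

module BarrierProperties {B : Family} (barrier : Barrier B) where
  open Barrier barrier
  open Enumeration base-infinite

  []∉B : ¬ B []
  []∉B B[] with base-infinite 0
  ... | _ , _ , s , Bs , n∈s =
    sperner [] s B[] Bs ((λ _ ()) , λ { refl → contradiction n∈s λ () })

  Proper : List ℕ → Set
  Proper w = ∃ λ r → B r × w ⊆ˡ r × ∃ λ c → c ∈ r × c ∉ w

  proper⇒no-member-⊆ : ∀ {w q} → Proper w → q ⊆ˡ w → ¬ B q
  proper⇒no-member-⊆ (r , Br , w⊆r , c , c∈r , c∉w) q⊆w Bq =
    sperner _ r Bq Br ((λ x → w⊆r x ∘ q⊆w x) , λ { refl → c∉w (q⊆w c c∈r) })

  proper⇒∉B : ∀ {w} → Proper w → ¬ B w
  proper⇒∉B proper = proper⇒no-member-⊆ proper (λ _ x∈w → x∈w)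

  proper-⊆ : ∀ {v w} → Proper v → w ⊆ˡ v → Proper w
  proper-⊆ (r , Br , v⊆r , c , c∈r , c∉v) w⊆v =
    r , Br , (λ x → v⊆r x ∘ w⊆v x) , c , c∈r , c∉v ∘ w⊆v c

  drop2nd-proper : ∀ {a c l r} → Incr (a ∷ c ∷ l) → (a ∷ c ∷ l) ⊆ˡ r → B r → Proper (a ∷ l)
  drop2nd-proper {a} {c} {l} incr ⊆r Br =
    _ , Br , (λ x → ⊆r x ∘ skip-⊆ a (c ∷ []) l x) , c , ⊆r c (there (here refl)) , Incr-∉ incr

  -- Condition (2) applied to w followed by y and then all of base B above y;
  -- by (3) the member found cannot lie inside w.
  proper⇒extension : ∀ {w y} → Proper w → Incr (w ++ y ∷ []) → base B y →
                     ∃ λ ts → B (w ++ y ∷ ts)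
  proper⇒extension {w} {y} proper@(r , Br , w⊆r , _) incr By
    with initial (w ++ₛ (y ∷ []) ++ₛ enumFrom (suc y))
                 (++ₛ-incr w incr
                   (++ₛ-incr (y ∷ []) (enumFrom-≥ (suc y) 0 ∷ [-]) (enumFrom-incr _)))
                 (++ₛ-all {base B} w (λ x x∈w → r , Br , w⊆r x x∈w)
                   (++ₛ-all {base B} (y ∷ []) (λ { _ (here refl) → By }) (enumFrom-∈ _)))
  ... | k , Bk with initSeg-++ₛ w _ k
  ...   | inj₁ ⊆w       = contradiction Bk (proper⇒no-member-⊆ proper ⊆w)
  ...   | inj₂ (n , eq) = _ , subst B eq Bk

  lexUpperBound : ∀ a → ∃ λ t → B t × ∀ zs → (a ∷ zs) <lex t
  lexUpperBound a with initial (enumFrom (suc a)) (enumFrom-incr _) (enumFrom-∈ _)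
  ... | zero  , B[] = contradiction B[] []∉B
  ... | suc k , Bt  = _ , Bt , λ zs → diff [] zs _ a _ (enumFrom-≥ (suc a) 0)

  proper-exchange : ∀ a c u xs {y} → Incr (a ∷ c ∷ u ++ xs) → Proper (a ∷ c ∷ u ++ xs) →
                    base B y →
                    (∀ x → x ∈ a ∷ c ∷ u ++ xs → x < y) →
                    Incr (a ∷ u ++ xs ++ y ∷ []) × Proper (a ∷ u ++ xs ++ y ∷ [])
  proper-exchange a c u xs {y} incr proper By below =
    subst Incr assoc (Incr-drop2nd incr-y) ,
    subst Proper assoc (drop2nd-proper incr-y (snoc-⊆ (a ∷ c ∷ u ++ xs) ts) Bext)
    where
      incr-y : Incr ((a ∷ c ∷ u ++ xs) ++ y ∷ [])
      incr-y = Incr-snoc incr below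
      assoc : a ∷ (u ++ xs) ++ y ∷ [] ≡ a ∷ u ++ xs ++ y ∷ []
      assoc = cong (a ∷_) (++-assoc u xs (y ∷ []))
      ts : List ℕ
      ts = proj₁ (proper⇒extension proper incr-y By)
      Bext : B ((a ∷ c ∷ u ++ xs) ++ y ∷ ts)
      Bext = proj₂ (proper⇒extension proper incr-y By)

-- Order embeddings of barriers into ω^ω

module OrderEmbedding {B : Family} (barrier : Barrier B) (f : List ℕ → List ℕ)
                      (f-cnf : ∀ s → B s → CNF (f s))
                      (f-mono : ∀ s t → B s → B t → s <lex t → f s <ω^ω f t) where
  open Barrier barrier
  open BarrierProperties barrier
  open Enumeration base-infinite

  f-<ᶜ : ∀ {s t} → B s → B t → s <lex t → f s <ᶜ f t
  f-<ᶜ Bs Bt s<t = <ω^ω⇒<ᶜ (f-mono _ _ Bs Bt s<t)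

  proper⇒<[length] : ∀ a u xs → Incr (a ∷ u ++ xs) → Proper (a ∷ u ++ xs) →
                     ∀ {β} → CNF β → (∀ {r} → B r → (a ∷ xs) ⊑ r → f r <ᶜ β) →
                     ∀ {r} → B r → (a ∷ xs) ⊑ r → f r <[ length u ] β
  proper⇒<[length] a [] xs _ _ _ below Br w⊑r =
    subst₂ _<ᶜ_ (sym (truncate-zero _)) (sym (truncate-zero _)) (below Br w⊑r)
  proper⇒<[length] a (c ∷ u) xs _ proper _ _ Br ([] , refl) =
    contradiction (subst B (++-identityʳ (a ∷ xs)) Br)
                  (proper⇒∉B (proper-⊆ proper (skip-⊆ a (c ∷ u) xs)))
  proper⇒<[length] a (c ∷ u) xs incr proper {β} cnfβ below {r} Br (z ∷ zs , refl) =
    ascending⇒<[suc] cnfβ (λ i → f-cnf _ (B-r′ i)) r<r′ r′<β ascending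
    where
      y : ℕ → ℕ
      y = enumFrom (suc (sum (z ∷ a ∷ c ∷ u ++ xs)))
      y-above : ∀ i x → x ∈ z ∷ a ∷ c ∷ u ++ xs → x < y i
      y-above i x = enumFrom-beyond (z ∷ a ∷ c ∷ u ++ xs) i
      w⊆v : (a ∷ xs) ⊆ˡ (a ∷ c ∷ u ++ xs)
      w⊆v = skip-⊆ a (c ∷ u) xs
      extension : ∀ i → ∃ λ ts → B (a ∷ xs ++ y i ∷ ts)
      extension i = proper⇒extension (proper-⊆ proper w⊆v)
        (Incr-snoc (Incr-dropInfix (c ∷ u) incr) (λ x x∈ → y-above i x (there (w⊆v x x∈))))
        (enumFrom-∈ _ i)
      r′ : ℕ → List ℕ
      r′ i = a ∷ xs ++ y i ∷ proj₁ (extension i)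
      B-r′ : ∀ i → B (r′ i)
      B-r′ i = proj₂ (extension i)
      r<r′ : ∀ i → f r <ᶜ f (r′ i)
      r<r′ i = f-<ᶜ Br (B-r′ i) (diff (a ∷ xs) zs _ z (y i) (y-above i z (here refl)))
      r′<β : ∀ i → f (r′ i) <ᶜ β
      r′<β i = below (B-r′ i) (_ , refl)
      ascending : ∀ i → f (r′ i) <[ length u ] f (r′ (suc i))
      ascending i =
        let incr′ , proper′ =
              proper-exchange a c u xs incr proper (enumFrom-∈ _ i) (λ x → y-above i x ∘ there)
        in proper⇒<[length] a u (xs ++ y i ∷ []) incr′ proper′ (f-cnf _ (B-r′ (suc i)))
             (λ Br″ ⊑r″ → f-<ᶜ Br″ (B-r′ (suc i))
                             (snoc-⊑⇒<lex (a ∷ xs) _ ⊑r″ (enumFrom-incr _ i)))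
             (B-r′ i) (_ , cong (a ∷_) (++-assoc xs _ _))

  bound : ℕ → ℕ
  bound a = 2 + leadingExponent (f (proj₁ (lexUpperBound a)))

  bounded : ∀ s → B s → LenBound bound s
  bounded []          _  = tt
  bounded (a ∷ [])    _  = s≤s z≤n
  bounded (a ∷ c ∷ u) Bs = s≤s (s≤s (<[]⇒≤leadingExponent {x = f (a ∷ c ∷ u)} (f t)
    (proper⇒<[length] a u [] incr proper (f-cnf _ Bt) below-t Bs (c ∷ u , refl))))
    where
      t : List ℕ
      t = proj₁ (lexUpperBound a)
      Bt : B t
      Bt = proj₁ (proj₂ (lexUpperBound a))
      incr-s : Incr (a ∷ c ∷ u)
      incr-s = members-incr _ Bs
      ++[] : a ∷ u ≡ a ∷ u ++ []
      ++[] = cong (a ∷_) (sym (++-identityʳ u))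
      incr : Incr (a ∷ u ++ [])
      incr = subst Incr ++[] (Incr-drop2nd incr-s)
      proper : Proper (a ∷ u ++ [])
      proper = subst Proper ++[] (drop2nd-proper incr-s (λ _ x∈ → x∈) Bs)
      below-t : ∀ {r} → B r → (a ∷ []) ⊑ r → f r <ᶜ f t
      below-t Br (zs , refl) = f-<ᶜ Br Bt (proj₂ (proj₂ (lexUpperBound a)) zs)

OrderTypeLeωω⇒ωBounded : ∀ {B} → Barrier B → OrderTypeLeωω B → ωBounded B
OrderTypeLeωω⇒ωBounded barrier (f , f-cnf , f-mono) = bound , bounded
  where open OrderEmbedding barrier f f-cnf f-mono

lemma5p7 : (B : Family) → Barrier B → (OrderTypeLeωω B ⇔ ωBounded B)
lemma5p7 B barrier = mk⇔ (OrderTypeLeωω⇒ωBounded barrier) (ωBounded⇒OrderTypeLeωω B)
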